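{- Let $P\in\mathcal{C}(G_n)$ and let $\mathrm{char}(P)=C$. Then \[\mathrm{char}(\mathrm{weave}_k^1(P))=\{T^k: T\in C\} \cup\{Q_{n+1}\}.\]
   Context: Let $Q_n=\{1,\dots,n\}$ be a set of $n$ yes/no questions; an outcome on $S\subseteq Q_n$ is an element of $\{0,1\}^{|S|}$, and $X_S$ is the set of outcomes on $S$. A preference matrix on $Q_n$ is a $2^n\times n$ 0-1 matrix whose rows are the $2^n$ outcomes, each exactly once, ordered from most to least preferred. For a nonempty proper $S\subset Q_n$ and outcome $x$ on $Q_n-S$, $P^{[Q_n-S,x]}$ is the submatrix formed by the columns in $S$ and rows with outcome $x$ on $Q_n-S$ (in order); $S$ is separable with respect to $P$ if $P^{[Q_n-S,x]}=P^{[Q_n-S,y]}$ for all $x,y\in X_{Q_n-S}$; $\emptyset$ and $Q_n$ are always separable. The character $\mathrm{char}(P)$ is the set of all subsets of $Q_n$ separable with respect to $P$. $\mathcal{C}(G_n)$ is the set of preference matrices generated by Hamiltonian paths in the $n$-dimensional hypercube graph $G_n$ with Gray code labeling, i.e. preference matrices in which consecutive rows differ in exactly one entry. For $A\in\mathcal{C}(G_n)$ and $k\in\{1,\dots,n+1\}$, $\mathrm{weave}_k^1(A)$ is the $2^{n+1}\times(n+1)$ matrix obtained by duplicating each row of $A$ (rows $2i-1$ and $2i$ both equal row $i$ of $A$) and inserting a new column in position $k$ (shifting later columns right) whose $i$-th entry is $1$ if $i\equiv 0,1 \pmod 4$ and $0$ if $i\equiv 2,3\pmod 4$. For $T\subseteq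 Q_n$, $T^k=\{q\in T : q<k\}\cup\{q+1 : q\in T \text{ and } q \geq k\}$. -}

module Defs where

open import Data.Bool using (Bool; true; false; if_then_else_; _∧_)
open import Data.Bool.Properties using () renaming (_≟_ to _≟ᵇ_)
open import Data.Nat using (ℕ; zero; suc; _^_; _%_; _≤ᵇ_)
open import Data.Fin using (Fin)
open import Data.Fin.Subset using (Subset; ⊤; ⊥)
open import Data.Vec using (Vec; []; _∷_; insertAt)
open import Data.List using (List; []; _∷_; length; map)
open import Data.List.Membership.Propositional using (_∈_)
open import Data.List.Relation.Unary.Unique.Propositional using (Unique)
open import Data.List.Relation.Unary.Linked using (Linked)
open import Data.Product using (_×_)
open import Data.Sum using (_⊎_)
open import Relation.Nullary using (does)
open import Relation.Binary.PropositionalEquality using (_≡_)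

-- Questions Q_n are Fin n (question q+1 of the paper is index q).
-- An outcome on Q_n is a Vec Bool n (true = 1 = yes).
Outcome : ℕ → Set
Outcome n = Vec Bool n

-- A matrix with n columns is the list of its rows, top (most preferred) first.
Matrix : ℕ → Set
Matrix n = List (Outcome n)

IsPrefMatrix : (n : ℕ) → Matrix n → Set
IsPrefMatrix n P = (length P ≡ 2 ^ n) × Unique P × (∀ (x : Outcome n) → x ∈ P)

hamming : ∀ {n} → Outcome n → Outcome n → ℕ
hamming []       []       = 0
hamming (a ∷ as) (b ∷ bs) = if does (a ≟ᵇ b) then hamming as bs else suc (hamming as bs)

InCG : (n : ℕ) → Matrix n → Set
InCG n P = IsPrefMatrix n P × Linked (λ r s → hamming r s ≡ 1) P

restrict : ∀ {n} → Subset n → Outcome n → List Bool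
restrict []          []       = []
restrict (true ∷ S)  (b ∷ r)  = b ∷ restrict S r
restrict (false ∷ S) (b ∷ r)  = restrict S r

agreeOutside : ∀ {n} → Subset n → Outcome n → Outcome n → Bool
agreeOutside []          []      []      = true
agreeOutside (true ∷ S)  (_ ∷ r) (_ ∷ x) = agreeOutside S r x
agreeOutside (false ∷ S) (a ∷ r) (b ∷ x) = does (a ≟ᵇ b) ∧ agreeOutside S r x

filterᵇ : ∀ {A : Set} → (A → Bool) → List A → List A
filterᵇ p []       = []
filterᵇ p (a ∷ as) = if p a then a ∷ filterᵇ p as else filterᵇ p as

-- P^{[Q_n - S, x]}: the outcome on Q_n - S is given as the restriction of a
-- full outcome x (every outcome on Q_n - S arises this way).
subMatrix : ∀ {n} → Subset n → Outcome n → Matrix n → List (List Bool)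
subMatrix S x P = map (restrict S) (filterᵇ (λ r → agreeOutside S r x) P)

Separable : ∀ {n} → Subset n → Matrix n → Set
Separable {n} S P =
  (S ≡ ⊥) ⊎ (S ≡ ⊤) ⊎ (∀ (x y : Outcome n) → subMatrix S x P ≡ subMatrix S y P)

-- New column entry for (1-indexed) row i: 1 iff i ≡ 0,1 (mod 4).
newCol : ℕ → Bool
newCol i = (i % 4) ≤ᵇ 1

double : ∀ {n} → Matrix n → Matrix n
double []       = []
double (r ∷ rs) = r ∷ r ∷ double rs

insertCol : ∀ {n} → Fin (suc n) → ℕ → Matrix n → Matrix (suc n)
insertCol k i []       = []
insertCol k i (r ∷ rs) = insertAt r k (newCol i) ∷ insertCol k (suc i) rs

-- weave_k^1; the paper's k ∈ {1,…,n+1} is k = toℕ k' + 1 for k' : Fin (suc n).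
weave : ∀ {n} → Fin (suc n) → Matrix n → Matrix (suc n)
weave k A = insertCol k 1 (double A)

shiftSet : ∀ {n} → Subset n → Fin (suc n) → Subset (suc n)
shiftSet T k = insertAt T k false

-- Consecutive rows of a Gray-code matrix differ in one entry, hence have opposite
-- parity, so the two copies of a row r in weave_k^1(P) carry the new entries
-- parity r ⊕ c and its negation, for one constant c. For T avoiding the new
-- question, fixing the new entry selects exactly one copy of every row of P, so T
-- is separable for the weave iff its preimage is separable for P. If T contains
-- the new question but misses some q, compare two outcomes differing only at q:
-- the first rows of their submatrices agree on T and otherwise agree with the two
-- outcomes, so they differ only at q; their parities, hence their new entries,
-- differ, and so do the two submatrices.
module Submission where

open import Defs
open import Data.Bool using (Bool; true; false; not; _xor_; _∧_; if_then_else_)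
open import Data.Bool.Properties
  using (∧-assoc; ∧-comm; ∧-conicalˡ; ∧-conicalʳ; not-involutive; not-¬; not-distribˡ-xor; not-distribʳ-xor; xor-same)
  renaming (_≟_ to _≟ᵇ_)
open import Data.Empty using (⊥-elim)
open import Data.Fin using (Fin; zero; suc)
open import Data.Fin.Subset using (Subset; ⊤)
open import Data.List using (List; []; _∷_; map)
open import Data.List.Properties using (∷-injective; ∷-injectiveˡ; map-∘; map-cong)
open import Data.List.Membership.Propositional using (_∈_)
open import Data.List.Relation.Unary.Any using (here; there)
open import Data.List.Relation.Unary.Linked using (Linked; _∷_)
open import Data.Nat using (ℕ; zero; suc; _+_; _*_; _≤ᵇ_)
open import Data.Nat.DivMod using ([m+n]%n≡m%n)
open import Data.Nat.Properties using (+-comm; suc-injective)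
open import Data.Product using (Σ; ∃-syntax; _×_; _,_)
open import Data.Sum using (_⊎_; inj₁; inj₂)
open import Data.Vec using (Vec; []; _∷_; insertAt; removeAt; lookup; replicate; updateAt)
open import Data.Vec.Properties using (insertAt-lookup; insertAt-removeAt; removeAt-insertAt)
open import Function using (_∘_)
open import Function.Bundles using (_⇔_; mk⇔; Equivalence)
open import Function.Construct.Composition using (_⇔-∘_)
open import Function.Construct.Symmetry using (⇔-sym)
open import Relation.Nullary using (does; ¬_)
open import Relation.Nullary.Decidable using (dec-true)
open import Relation.Binary.PropositionalEquality
  using (_≡_; _≢_; refl; sym; trans; cong; cong₂; subst; module ≡-Reasoning)

open Equivalence using (to; from)
open ≡-Reasoning

private
  variable
    n : ℕ
    A : Set

insertAt-injective : ∀ (xs ys : Vec A n) (k : Fin (suc n)) {v w : A} →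
                     insertAt xs k v ≡ insertAt ys k w → xs ≡ ys
insertAt-injective xs ys k {v} {w} e = begin
  xs                           ≡⟨ sym (removeAt-insertAt xs k v) ⟩
  removeAt (insertAt xs k v) k ≡⟨ cong (λ zs → removeAt zs k) e ⟩
  removeAt (insertAt ys k w) k ≡⟨ removeAt-insertAt ys k w ⟩
  ys                           ∎

insertAt-≢ : ∀ {xs ys : Vec A n} {k : Fin (suc n)} {v w : A} →
             v ≢ w → insertAt xs k v ≢ insertAt ys k w
insertAt-≢ {xs = xs} {ys} {k} {v} {w} v≢w e =
  v≢w (trans (sym (insertAt-lookup xs k v)) (trans (cong (λ zs → lookup zs k) e) (insertAt-lookup ys k w)))

insertAt-replicate : ∀ (v : A) (k : Fin (suc n)) → insertAt (replicate n v) k v ≡ replicate (suc n) v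
insertAt-replicate v zero = refl
insertAt-replicate {n = suc n} v (suc k) = cong (v ∷_) (insertAt-replicate v k)

insertAt≡replicate⇔ : ∀ {xs : Vec A n} {k : Fin (suc n)} {v : A} →
                       insertAt xs k v ≡ replicate (suc n) v ⇔ xs ≡ replicate n v
insertAt≡replicate⇔ {xs = xs} {k} {v} = mk⇔
  (λ e → insertAt-injective xs _ k (trans e (sym (insertAt-replicate v k))))
  (λ { refl → insertAt-replicate v k })

insertAt-≢-replicate : ∀ {xs : Vec A n} {k : Fin (suc n)} {v w : A} →
                       v ≢ w → insertAt xs k v ≢ replicate (suc n) w
insertAt-≢-replicate {k = k} {w = w} v≢w e = insertAt-≢ v≢w (trans e (sym (insertAt-replicate w k)))

≡⊤⊎∉ : ∀ (S : Subset n) → S ≡ ⊤ ⊎ ∃[ q ] lookup S q ≡ false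
≡⊤⊎∉ [] = inj₁ refl
≡⊤⊎∉ (false ∷ S) = inj₂ (zero , refl)
≡⊤⊎∉ (true ∷ S) with ≡⊤⊎∉ S
... | inj₁ S≡⊤ = inj₁ (cong (true ∷_) S≡⊤)
... | inj₂ (q , q∉S) = inj₂ (suc q , q∉S)

filterᵇ-all : ∀ (p : A → Bool) (xs : List A) → (∀ x → p x ≡ true) → filterᵇ p xs ≡ xs
filterᵇ-all p [] _ = refl
filterᵇ-all p (x ∷ xs) all rewrite all x = cong (x ∷_) (filterᵇ-all p xs all)

filterᵇ-nonempty : ∀ (p : A → Bool) {x : A} (xs : List A) → x ∈ xs → p x ≡ true →
                   ∃[ y ] ∃[ ys ] filterᵇ p xs ≡ y ∷ ys × p y ≡ true
filterᵇ-nonempty p (x ∷ xs) (here refl) px rewrite px = x , filterᵇ p xs , refl , px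
filterᵇ-nonempty p (y ∷ xs) (there x∈xs) px with p y in py
... | true  = y , filterᵇ p xs , refl , py
... | false = filterᵇ-nonempty p xs x∈xs px

does-≟ᵇ-refl : ∀ a → does (a ≟ᵇ a) ≡ true
does-≟ᵇ-refl a = dec-true (a ≟ᵇ a) refl

does-≟ᵇ⇒≡ : ∀ {a b} → does (a ≟ᵇ b) ≡ true → a ≡ b
does-≟ᵇ⇒≡ {true}  {true}  _ = refl
does-≟ᵇ⇒≡ {false} {false} _ = refl

parity : Outcome n → Bool
parity [] = false
parity (a ∷ r) = a xor parity r

hamming-refl : ∀ (r : Outcome n) → hamming r r ≡ 0
hamming-refl [] = refl
hamming-refl (a ∷ r) rewrite does-≟ᵇ-refl a = hamming-refl r

hamming≡0⇒≡ : ∀ (r s : Outcome n) → hamming r s ≡ 0 → r ≡ s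
hamming≡0⇒≡ [] [] _ = refl
hamming≡0⇒≡ (true ∷ r) (true ∷ s) h = cong (true ∷_) (hamming≡0⇒≡ r s h)
hamming≡0⇒≡ (false ∷ r) (false ∷ s) h = cong (false ∷_) (hamming≡0⇒≡ r s h)

hamming≡1⇒parity≡not : ∀ (r s : Outcome n) → hamming r s ≡ 1 → parity r ≡ not (parity s)
hamming≡1⇒parity≡not [] [] ()
hamming≡1⇒parity≡not (true ∷ r) (true ∷ s) h = cong not (hamming≡1⇒parity≡not r s h)
hamming≡1⇒parity≡not (false ∷ r) (false ∷ s) h = hamming≡1⇒parity≡not r s h
hamming≡1⇒parity≡not (true ∷ r) (false ∷ s) h = cong (not ∘ parity) (hamming≡0⇒≡ r s (suc-injective h))
hamming≡1⇒parity≡not (false ∷ r) (true ∷ s) h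
  rewrite hamming≡0⇒≡ r s (suc-injective h) = sym (not-involutive (parity s))

hamming-updateAt-not : ∀ (x : Outcome n) q → hamming x (updateAt x q not) ≡ 1
hamming-updateAt-not (true ∷ x) zero = cong suc (hamming-refl x)
hamming-updateAt-not (false ∷ x) zero = cong suc (hamming-refl x)
hamming-updateAt-not (true ∷ x) (suc q) = hamming-updateAt-not x q
hamming-updateAt-not (false ∷ x) (suc q) = hamming-updateAt-not x q

Flips : (Outcome n → Bool) → Set
Flips {n} t = ∀ (r s : Outcome n) → hamming r s ≡ 1 → t r ≡ not (t s)

parity-flips : ∀ (c : Bool) → Flips {n} (λ r → parity r xor c)
parity-flips c r s h = begin
  parity r xor c       ≡⟨ cong (_xor c) (hamming≡1⇒parity≡not r s h) ⟩
  not (parity s) xor c ≡⟨ sym (not-distribˡ-xor (parity s) c) ⟩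
  not (parity s xor c) ∎

weaveBy : (Outcome n → Bool) → Fin (suc n) → Matrix n → Matrix (suc n)
weaveBy t k [] = []
weaveBy t k (r ∷ rs) = insertAt r k (t r) ∷ insertAt r k (not (t r)) ∷ weaveBy t k rs

newCol-periodic : ∀ i → newCol (4 + i) ≡ newCol i
newCol-periodic i = trans (cong newCol (+-comm 4 i)) (cong (_≤ᵇ 1) ([m+n]%n≡m%n i 4))

newCol-+2 : ∀ i → newCol (2 + i) ≡ not (newCol i)
newCol-+2 0 = refl
newCol-+2 1 = refl
newCol-+2 2 = refl
newCol-+2 3 = refl
newCol-+2 (suc (suc (suc (suc i)))) = begin
  newCol (4 + (2 + i))  ≡⟨ newCol-periodic (2 + i) ⟩
  newCol (2 + i)        ≡⟨ newCol-+2 i ⟩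
  not (newCol i)        ≡⟨ cong not (newCol-periodic i) ⟨
  not (newCol (4 + i))  ∎

newCol-odd : ∀ j → newCol (2 + j * 2) ≡ not (newCol (1 + j * 2))
newCol-odd zero = refl
newCol-odd (suc j) = begin
  newCol (2 + (2 + j * 2))       ≡⟨ newCol-+2 (2 + j * 2) ⟩
  not (newCol (2 + j * 2))       ≡⟨ cong not (newCol-odd j) ⟩
  not (not (newCol (1 + j * 2))) ≡⟨ cong not (newCol-+2 (1 + j * 2)) ⟨
  not (newCol (3 + j * 2))       ∎

-- The copies of the (j+1)-st row of P are the rows 1 + 2j and 2 + 2j of the weave.
insertCol-double : ∀ {t : Outcome n → Bool} → Flips t → (k : Fin (suc n)) → ∀ j r rs →
                   Linked (λ r s → hamming r s ≡ 1) (r ∷ rs) → t r ≡ newCol (1 + j * 2) →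
                   insertCol k (1 + j * 2) (double (r ∷ rs)) ≡ weaveBy t k (r ∷ rs)
insertCol-double {t = t} flips k j r rs gray tr≡new =
  cong₂ _∷_ (cong (insertAt r k) (sym tr≡new))
    (cong₂ _∷_ (cong (insertAt r k) (trans (newCol-odd j) (cong not (sym tr≡new)))) (rest rs gray))
  where
  rest : ∀ rs → Linked (λ r s → hamming r s ≡ 1) (r ∷ rs) →
         insertCol k (3 + j * 2) (double rs) ≡ weaveBy t k rs
  rest [] _ = refl
  rest (s ∷ rs) (r~s ∷ gray) = insertCol-double flips k (suc j) s rs gray (begin
    t s                      ≡⟨ not-involutive (t s) ⟨
    not (not (t s))          ≡⟨ cong not (flips r s r~s) ⟨
    not (t r)                ≡⟨ cong not tr≡new ⟩
    not (newCol (1 + j * 2)) ≡⟨ newCol-+2 (1 + j * 2) ⟨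
    newCol (3 + j * 2)       ∎)

weave≡weaveBy-parity : ∀ (k : Fin (suc n)) (P : Matrix n) → Linked (λ r s → hamming r s ≡ 1) P →
                       ∃[ c ] weave k P ≡ weaveBy (λ r → parity r xor c) k P
weave≡weaveBy-parity k [] _ = false , refl
weave≡weaveBy-parity k (r ∷ rs) gray =
  not (parity r) , insertCol-double (parity-flips (not (parity r))) k 0 r rs gray parity-xor-not
  where
  parity-xor-not : parity r xor not (parity r) ≡ true
  parity-xor-not = trans (sym (not-distribʳ-xor (parity r) (parity r))) (cong not (xor-same (parity r)))

agreeOutside-refl : ∀ (S : Subset n) x → agreeOutside S x x ≡ true
agreeOutside-refl [] [] = refl
agreeOutside-refl (true ∷ S) (a ∷ x) = agreeOutside-refl S x
agreeOutside-refl (false ∷ S) (a ∷ x) rewrite does-≟ᵇ-refl a = agreeOutside-refl S x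

agreeOutside-⊤ : ∀ (r x : Outcome n) → agreeOutside ⊤ r x ≡ true
agreeOutside-⊤ [] [] = refl
agreeOutside-⊤ (a ∷ r) (b ∷ x) = agreeOutside-⊤ r x

agreeOutside-insertAt-false : ∀ (S : Subset n) k r b x b′ →
  agreeOutside (insertAt S k false) (insertAt r k b) (insertAt x k b′) ≡ agreeOutside S r x ∧ does (b ≟ᵇ b′)
agreeOutside-insertAt-false S zero r b x b′ = ∧-comm (does (b ≟ᵇ b′)) (agreeOutside S r x)
agreeOutside-insertAt-false (true ∷ S) (suc k) (a ∷ r) b (e ∷ x) b′ = agreeOutside-insertAt-false S k r b x b′
agreeOutside-insertAt-false (false ∷ S) (suc k) (a ∷ r) b (e ∷ x) b′ =
  trans (cong (does (a ≟ᵇ e) ∧_) (agreeOutside-insertAt-false S k r b x b′)) (sym (∧-assoc (does (a ≟ᵇ e)) _ _))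

agreeOutside-insertAt-true : ∀ (S : Subset n) k r b x b′ →
  agreeOutside (insertAt S k true) (insertAt r k b) (insertAt x k b′) ≡ agreeOutside S r x
agreeOutside-insertAt-true S zero r b x b′ = refl
agreeOutside-insertAt-true (true ∷ S) (suc k) (a ∷ r) b (e ∷ x) b′ = agreeOutside-insertAt-true S k r b x b′
agreeOutside-insertAt-true (false ∷ S) (suc k) (a ∷ r) b (e ∷ x) b′ =
  cong (does (a ≟ᵇ e) ∧_) (agreeOutside-insertAt-true S k r b x b′)

restrict-insertAt-false : ∀ (S : Subset n) k r b → restrict (insertAt S k false) (insertAt r k b) ≡ restrict S r
restrict-insertAt-false S zero r b = refl
restrict-insertAt-false (true ∷ S) (suc k) (a ∷ r) b = cong (a ∷_) (restrict-insertAt-false S k r b)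
restrict-insertAt-false (false ∷ S) (suc k) (a ∷ r) b = restrict-insertAt-false S k r b

restrict-insertAt-true-injective : ∀ (S : Subset n) k r b r′ b′ →
  restrict (insertAt S k true) (insertAt r k b) ≡ restrict (insertAt S k true) (insertAt r′ k b′) →
  b ≡ b′ × restrict S r ≡ restrict S r′
restrict-insertAt-true-injective S zero r b r′ b′ = ∷-injective
restrict-insertAt-true-injective (true ∷ S) (suc k) (a ∷ r) b (a′ ∷ r′) b′ e
  with refl , e′ ← ∷-injective e
  with b≡b′ , r≡r′ ← restrict-insertAt-true-injective S k r b r′ b′ e′ = b≡b′ , cong (a ∷_) r≡r′
restrict-insertAt-true-injective (false ∷ S) (suc k) (a ∷ r) b (a′ ∷ r′) b′ =
  restrict-insertAt-true-injective S k r b r′ b′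

restrict-updateAt : ∀ (S : Subset n) x q (f : Bool → Bool) → lookup S q ≡ false →
                    restrict S (updateAt x q f) ≡ restrict S x
restrict-updateAt (false ∷ S) (a ∷ x) zero f _ = refl
restrict-updateAt (true ∷ S) (a ∷ x) (suc q) f q∉S = cong (a ∷_) (restrict-updateAt S x q f q∉S)
restrict-updateAt (false ∷ S) (a ∷ x) (suc q) f q∉S = restrict-updateAt S x q f q∉S

hamming-agreeOutside : ∀ (S : Subset n) r r′ x y → agreeOutside S r x ≡ true → agreeOutside S r′ y ≡ true →
                       restrict S r ≡ restrict S r′ → restrict S x ≡ restrict S y → hamming r r′ ≡ hamming x y
hamming-agreeOutside [] [] [] [] [] _ _ _ _ = refl
hamming-agreeOutside (true ∷ S) (a ∷ r) (a′ ∷ r′) (e ∷ x) (e′ ∷ y) r~x r′~y r≡r′ x≡y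
  with refl , r≡r′ ← ∷-injective r≡r′ | refl , x≡y ← ∷-injective x≡y
  rewrite does-≟ᵇ-refl a | does-≟ᵇ-refl e = hamming-agreeOutside S r r′ x y r~x r′~y r≡r′ x≡y
hamming-agreeOutside (false ∷ S) (a ∷ r) (a′ ∷ r′) (e ∷ x) (e′ ∷ y) r~x r′~y r≡r′ x≡y
  with refl ← does-≟ᵇ⇒≡ {a} {e} (∧-conicalˡ _ _ r~x) | refl ← does-≟ᵇ⇒≡ {a′} {e′} (∧-conicalˡ _ _ r′~y) =
  cong (λ h → if does (a ≟ᵇ a′) then h else suc h)
    (hamming-agreeOutside S r r′ x y (∧-conicalʳ _ _ r~x) (∧-conicalʳ _ _ r′~y) r≡r′ x≡y)

filterᵇ-weaveBy-insertAt-false : ∀ (t : Outcome n → Bool) k (S : Subset n) x b P →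
  filterᵇ (λ r → agreeOutside (insertAt S k false) r (insertAt x k b)) (weaveBy t k P)
    ≡ map (λ r → insertAt r k b) (filterᵇ (λ r → agreeOutside S r x) P)
filterᵇ-weaveBy-insertAt-false t k S x b [] = refl
filterᵇ-weaveBy-insertAt-false t k S x b (r ∷ P)
  rewrite agreeOutside-insertAt-false S k r (t r) x b | agreeOutside-insertAt-false S k r (not (t r)) x b
  with agreeOutside S r x | t r | b
... | false | _     | b′    = filterᵇ-weaveBy-insertAt-false t k S x b′ P
... | true  | true  | true  = cong (_ ∷_) (filterᵇ-weaveBy-insertAt-false t k S x true P)
... | true  | true  | false = cong (_ ∷_) (filterᵇ-weaveBy-insertAt-false t k S x false P)
... | true  | false | true  = cong (_ ∷_) (filterᵇ-weaveBy-insertAt-false t k S x true P)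
... | true  | false | false = cong (_ ∷_) (filterᵇ-weaveBy-insertAt-false t k S x false P)

filterᵇ-weaveBy-insertAt-true : ∀ (t : Outcome n → Bool) k (S : Subset n) x b P →
  filterᵇ (λ r → agreeOutside (insertAt S k true) r (insertAt x k b)) (weaveBy t k P)
    ≡ weaveBy t k (filterᵇ (λ r → agreeOutside S r x) P)
filterᵇ-weaveBy-insertAt-true t k S x b [] = refl
filterᵇ-weaveBy-insertAt-true t k S x b (r ∷ P)
  rewrite agreeOutside-insertAt-true S k r (t r) x b | agreeOutside-insertAt-true S k r (not (t r)) x b
  with agreeOutside S r x
... | false = filterᵇ-weaveBy-insertAt-true t k S x b P
... | true  = cong (λ rows → _ ∷ _ ∷ rows) (filterᵇ-weaveBy-insertAt-true t k S x b P)

subMatrix-weaveBy-insertAt-false : ∀ (t : Outcome n → Bool) k (S : Subset n) x b P →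
  subMatrix (insertAt S k false) (insertAt x k b) (weaveBy t k P) ≡ subMatrix S x P
subMatrix-weaveBy-insertAt-false t k S x b P = begin
  map (restrict S′) (filterᵇ _ (weaveBy t k P))
    ≡⟨ cong (map (restrict S′)) (filterᵇ-weaveBy-insertAt-false t k S x b P) ⟩
  map (restrict S′) (map (λ r → insertAt r k b) rows)
    ≡⟨ map-∘ rows ⟨
  map (λ r → restrict S′ (insertAt r k b)) rows
    ≡⟨ map-cong (λ r → restrict-insertAt-false S k r b) rows ⟩
  map (restrict S) rows ∎
  where
  S′ = insertAt S k false
  rows = filterᵇ (λ r → agreeOutside S r x) P

Uniform : Subset n → Matrix n → Set
Uniform {n} S P = ∀ (x y : Outcome n) → subMatrix S x P ≡ subMatrix S y P

uniform-⊤ : ∀ (P : Matrix n) → Uniform ⊤ P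
uniform-⊤ P x y = cong (map (restrict ⊤))
  (trans (filterᵇ-all _ P (λ r → agreeOutside-⊤ r x)) (sym (filterᵇ-all _ P (λ r → agreeOutside-⊤ r y))))

uniform-weaveBy-insertAt-false⇔ : ∀ (t : Outcome n → Bool) k (S : Subset n) P →
                                   Uniform (insertAt S k false) (weaveBy t k P) ⇔ Uniform S P
uniform-weaveBy-insertAt-false⇔ {n} t k S P = mk⇔
  (λ uniform x y → begin
    subMatrix S x P                                   ≡⟨ subMatrix-weaveBy-insertAt-false t k S x false P ⟨
    subMatrix S′ (insertAt x k false) (weaveBy t k P) ≡⟨ uniform _ _ ⟩
    subMatrix S′ (insertAt y k false) (weaveBy t k P) ≡⟨ subMatrix-weaveBy-insertAt-false t k S y false P ⟩
    subMatrix S y P                                   ∎)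
  (λ uniform x y → begin
    subMatrix S′ x (weaveBy t k P)  ≡⟨ split x ⟩
    subMatrix S (removeAt x k) P    ≡⟨ uniform _ _ ⟩
    subMatrix S (removeAt y k) P    ≡⟨ split y ⟨
    subMatrix S′ y (weaveBy t k P)  ∎)
  where
  S′ = insertAt S k false
  split : ∀ (x : Outcome (suc n)) → subMatrix S′ x (weaveBy t k P) ≡ subMatrix S (removeAt x k) P
  split x = trans (cong (λ x → subMatrix S′ x (weaveBy t k P)) (sym (insertAt-removeAt x k)))
                  (subMatrix-weaveBy-insertAt-false t k S (removeAt x k) (lookup x k) P)

subMatrix-weaveBy-insertAt-true-head : ∀ (t : Outcome n → Bool) k (S : Subset n) x b P → x ∈ P →
  ∃[ r ] ∃[ rest ] agreeOutside S r x ≡ true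
    × subMatrix (insertAt S k true) (insertAt x k b) (weaveBy t k P) ≡ restrict (insertAt S k true) (insertAt r k (t r)) ∷ rest
subMatrix-weaveBy-insertAt-true-head t k S x b P x∈P
  with r , rows , filter≡ , r~x ← filterᵇ-nonempty (λ r → agreeOutside S r x) P x∈P (agreeOutside-refl S x) =
  r , _ , r~x ,
  cong (map (restrict (insertAt S k true))) (trans (filterᵇ-weaveBy-insertAt-true t k S x b P) (cong (weaveBy t k) filter≡))

¬uniform-weaveBy-insertAt-true : ∀ {t : Outcome n → Bool} → Flips t → ∀ k (S : Subset n) q P → (∀ x → x ∈ P) →
                                 lookup S q ≡ false → ¬ Uniform (insertAt S k true) (weaveBy t k P)
¬uniform-weaveBy-insertAt-true {n} {t} flips k S q P complete q∉S uniform =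
  let x = replicate n false
      y = updateAt x q not
      r  , _ , r~x  , sub-x = subMatrix-weaveBy-insertAt-true-head t k S x false P (complete x)
      r′ , _ , r′~y , sub-y = subMatrix-weaveBy-insertAt-true-head t k S y false P (complete y)
      tr≡tr′ , r≡r′ = restrict-insertAt-true-injective S k r (t r) r′ (t r′)
                        (∷-injectiveˡ (trans (sym sub-x) (trans (uniform _ _) sub-y)))
      r~r′ = trans (hamming-agreeOutside S r r′ x y r~x r′~y r≡r′ (sym (restrict-updateAt S x q not q∉S)))
                   (hamming-updateAt-not x q)
  in not-¬ tr≡tr′ (flips r r′ r~r′)

separable-weaveBy-insertAt-false⇔ : ∀ (t : Outcome n → Bool) k (S : Subset n) P →
                                     Separable (insertAt S k false) (weaveBy t k P) ⇔ Separable S P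
separable-weaveBy-insertAt-false⇔ t k S P = mk⇔
  (λ { (inj₁ S′≡⊥)          → inj₁ (to insertAt≡replicate⇔ S′≡⊥)
     ; (inj₂ (inj₁ S′≡⊤))   → ⊥-elim (insertAt-≢-replicate (λ ()) S′≡⊤)
     ; (inj₂ (inj₂ uniform)) → inj₂ (inj₂ (to uniform⇔ uniform)) })
  (λ { (inj₁ S≡⊥)           → inj₁ (from insertAt≡replicate⇔ S≡⊥)
     ; (inj₂ (inj₁ refl))   → inj₂ (inj₂ (from uniform⇔ (uniform-⊤ P)))
     ; (inj₂ (inj₂ uniform)) → inj₂ (inj₂ (from uniform⇔ uniform)) })
  where
  uniform⇔ = uniform-weaveBy-insertAt-false⇔ t k S P

separable-weaveBy-insertAt-true⇔ : ∀ {t : Outcome n → Bool} → Flips t → ∀ k (S : Subset n) P → (∀ x → x ∈ P) →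
                                    Separable (insertAt S k true) (weaveBy t k P) ⇔ S ≡ ⊤
separable-weaveBy-insertAt-true⇔ flips k S P complete = mk⇔
  (λ { (inj₁ S′≡⊥)          → ⊥-elim (insertAt-≢-replicate (λ ()) S′≡⊥)
     ; (inj₂ (inj₁ S′≡⊤))   → to insertAt≡replicate⇔ S′≡⊤
     ; (inj₂ (inj₂ uniform)) → S≡⊤ uniform })
  (λ S≡⊤ → inj₂ (inj₁ (from insertAt≡replicate⇔ S≡⊤)))
  where
  S≡⊤ : Uniform (insertAt S k true) (weaveBy _ k P) → S ≡ ⊤
  S≡⊤ uniform with ≡⊤⊎∉ S
  ... | inj₁ S≡⊤ = S≡⊤
  ... | inj₂ (q , q∉S) = ⊥-elim (¬uniform-weaveBy-insertAt-true flips k S q P complete q∉S uniform)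

ShiftedChar : Fin (suc n) → Matrix n → Subset (suc n) → Set
ShiftedChar {n} k P T = (Σ (Subset n) λ T′ → Separable T′ P × T ≡ shiftSet T′ k) ⊎ T ≡ ⊤

shiftedChar-insertAt-false⇔ : ∀ k (S : Subset n) P → ShiftedChar k P (insertAt S k false) ⇔ Separable S P
shiftedChar-insertAt-false⇔ k S P = mk⇔
  (λ { (inj₁ (T′ , separable , S′≡T′ᵏ)) → subst (λ T → Separable T P) (sym (insertAt-injective S T′ k S′≡T′ᵏ)) separable
     ; (inj₂ S′≡⊤) → ⊥-elim (insertAt-≢-replicate (λ ()) S′≡⊤) })
  (λ separable → inj₁ (S , separable , refl))

shiftedChar-insertAt-true⇔ : ∀ k (S : Subset n) P → ShiftedChar k P (insertAt S k true) ⇔ S ≡ ⊤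
shiftedChar-insertAt-true⇔ k S P = mk⇔
  (λ { (inj₁ (_ , _ , S′≡T′ᵏ)) → ⊥-elim (insertAt-≢ (λ ()) S′≡T′ᵏ)
     ; (inj₂ S′≡⊤) → to insertAt≡replicate⇔ S′≡⊤ })
  (λ S≡⊤ → inj₂ (from insertAt≡replicate⇔ S≡⊤))

char-weaveBy : ∀ {t : Outcome n → Bool} → Flips t → ∀ k (P : Matrix n) → (∀ x → x ∈ P) →
               ∀ T → Separable T (weaveBy t k P) ⇔ ShiftedChar k P T
char-weaveBy {t = t} flips k P complete T =
  subst (λ T → Separable T (weaveBy t k P) ⇔ ShiftedChar k P T) (insertAt-removeAt T k)
        (byNewQuestion (removeAt T k) (lookup T k))
  where
  byNewQuestion : ∀ S b → Separable (insertAt S k b) (weaveBy t k P) ⇔ ShiftedChar k P (insertAt S k b)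
  byNewQuestion S false =
    ⇔-sym (shiftedChar-insertAt-false⇔ k S P) ⇔-∘ separable-weaveBy-insertAt-false⇔ t k S P
  byNewQuestion S true =
    ⇔-sym (shiftedChar-insertAt-true⇔ k S P) ⇔-∘ separable-weaveBy-insertAt-true⇔ flips k S P complete

theorem6 : (n : ℕ) (P : Matrix n) → InCG n P → (k : Fin (suc n)) →
    (T : Subset (suc n)) →
      Separable T (weave k P) ⇔ ((Σ (Subset n) λ T′ → Separable T′ P × T ≡ shiftSet T′ k) ⊎ T ≡ ⊤)
theorem6 n P ((_ , _ , complete) , gray) k T =
  let c , weave≡ = weave≡weaveBy-parity k P gray
  in subst (λ W → Separable T W ⇔ ShiftedChar k P T) (sym weave≡)
           (char-weaveBy (parity-flips c) k P complete T)
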